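{- Let $\pi$ be a permutation of $[n]$, $n\ge 1$, with factorization $\pi=\pi_1\pi_2\cdots\pi_q$ into indecomposable components. Then $\pi$ is full if and only if each component $\pi_j$ is full.
   Context: $[n]=\{1,\dots,n\}$; one-line notation, products are concatenations. The permutation matrix of a permutation $a_1\cdots a_n$ of $[n]$ has a $1$ in row $n+1-a_j$, column $j$. Bootstrap percolation: a cell is mutable if it contains $0$ and at least two of its orthogonal neighbours contain $1$; mutable cells are changed to $1$ one at a time until none remain (final configuration independent of the order). A permutation of $[k]$ is full if the final configuration is the all-ones $k\times k$ matrix. For a word $w$ of distinct integers, its reduced form replaces the $i$-th smallest entry by $i$; $w$ is full (resp. indecomposable) if its reduced form is. A permutation $\sigma$ of $[k]$ is indecomposable if there is no $1\le j<k$ with $\sigma(\{1,\dots,j\})=\{1,\dots,j\}$. Indecomposable components: $\pi_1$ is the longest indecomposable prefix of $\pi$, and the remaining components are obtained recursively from the remaining word. -}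

module Defs where

open import Data.Nat using (ℕ; zero; suc; _+_; _≤_; _<_; _<?_; _≡ᵇ_; pred)
open import Data.Bool using (Bool; true; false; if_then_else_)
open import Data.List using (List; []; _∷_; _++_; length; map; filter; upTo; take)
open import Data.Fin using (Fin; toℕ; fromℕ<)
open import Data.Product using (Σ; _×_; ∃)
open import Relation.Nullary using (¬_)
open import Relation.Binary.PropositionalEquality using (_≡_; _≢_)
open import Relation.Binary.Construct.Closure.ReflexiveTransitive using (Star)
open import Data.List.Relation.Binary.Permutation.Propositional using (_↭_)

[_] : ℕ → List ℕ
[ n ] = map suc (upTo n)

-- reduced form: the i-th smallest entry is replaced by i
-- (for words of distinct entries: rank = 1 + #entries smaller)
reduce : List ℕ → List ℕ
reduce w = map (λ x → suc (length (filter (_<? x) w))) w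

-- value of a word at 0-based position j (0 outside)
at : List ℕ → ℕ → ℕ
at []      _       = 0
at (x ∷ w) zero    = x
at (x ∷ w) (suc j) = at w j

-- 0/1 configurations on cells (r , c) with 0-based row r and column c;
-- only cells with r < k, c < k are meaningful (others stay false)
Config : Set
Config = ℕ → ℕ → Bool

-- permutation matrix of a permutation a₁⋯a_k of [k]:
-- 1 in (1-based) row k+1-a_j, column j, i.e. 0-based row r, column c
-- with r + a_{c+1} = k.
permMatrix : List ℕ → Config
permMatrix a r c with c <? length a
... | Relation.Nullary.yes _ = (r + at a c) ≡ᵇ length a
... | Relation.Nullary.no  _ = false

b2n : Bool → ℕ
b2n true  = 1
b2n false = 0

-- number of orthogonal neighbours containing 1
-- (cells outside the k×k grid contribute nothing: row/column r+1, c+1 = k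
--  are false by the invariant that only grid cells are ever set)
nbCount : Config → ℕ → ℕ → ℕ
nbCount m r c =
  b2n (if r ≡ᵇ 0 then false else m (pred r) c) +
  b2n (m (suc r) c) +
  b2n (if c ≡ᵇ 0 then false else m r (pred c)) +
  b2n (m r (suc c))

set1 : Config → ℕ → ℕ → Config
set1 m r c r' c' = if (r ≡ᵇ r') Data.Bool.∧ (c ≡ᵇ c') then true else m r' c'

data Step (k : ℕ) : Config → Config → Set where
  mutate : ∀ {m} r c → r < k → c < k → m r c ≡ false → 2 ≤ nbCount m r c →
           Step k m (set1 m r c)

-- a permutation a of [k] (k = length a) is full if the process
-- started from its permutation matrix can reach the all-ones k×k matrix
-- (which is terminal; the final configuration is order-independent)
FullPerm : List ℕ → Set
FullPerm a = ∃ λ m → Star (Step (length a)) (permMatrix a) m ×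
             (∀ r c → r < length a → c < length a → m r c ≡ true)

Full : List ℕ → Set
Full w = FullPerm (reduce w)

IndecPerm : List ℕ → Set
IndecPerm σ = ∀ j → 1 ≤ j → j < length σ → ¬ (take j σ ↭ [ j ])

Indec : List ℕ → Set
Indec w = IndecPerm (reduce w)

data Components : List ℕ → List (List ℕ) → Set where
  done : Components [] []
  next : ∀ {w} p rest {cs} → p ≢ [] → p ++ rest ≡ w → Indec p →
         (∀ m → length p < m → m ≤ length w → ¬ Indec (take m w)) →
         Components rest cs → Components w (p ∷ cs)

{-# OPTIONS --safe #-}
module Submission where

-- Write π = p π′ with p its first component. Every entry of p is smaller than every entry of π′:
-- the shortest prefix of π whose entries are smaller than all the others cannot be shorter than p
-- (p would decompose) nor longer (it would be an indecomposable prefix longer than p). So the reduced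
-- form of π is the direct sum of those of p and π′, and by induction on the components it suffices to
-- show that b ⊕ c is full iff b and c are.
--
-- In the matrix of b ⊕ c, b occupies the bottom-left block, c the top-right block, and the other
-- two blocks are empty. If b and c are full, percolate each inside its block; the two full blocks
-- then fill the top-left block row by row from its bottom-right corner, and the bottom-right block
-- from its top-left corner. Conversely, a run on b ⊕ c is covered by runs on b and on c: a cell of
-- the top-left block can only be occupied once the top row of b to its right and the left column
-- of c below it are full (dually for the bottom-right block), so the empty blocks never supply a
-- second occupied neighbour to a cell of b or c that the runs on b and c could not occupy themselves.

open import Defs
open import Data.Bool using (Bool; true; false; if_then_else_)
open import Data.Bool.Properties using (T-≡)
open import Data.Empty using (⊥; ⊥-elim)
open import Data.List using (List; []; _∷_; _++_; length; map; filter; take; drop)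
open import Data.List.Properties
  using (length-++; length-map; length-take; map-++; map-∘; map-id; map-cong; map-cong-local; map-upTo;
         ++-identityʳ; filter-++; filter-all; filter-none; filter-notAll; filter-accept; filter-reject;
         take-map; take-take; take-all; drop-all; take++drop≡id)
open import Data.List.Membership.Propositional using (_∈_)
open import Data.List.Membership.Propositional.Properties using (∈-map⁺; ∈-map⁻; ∈-applyUpTo⁻; ∈-upTo⁺)
open import Data.List.Relation.Binary.Permutation.Propositional using (_↭_; ↭-sym; ↭-trans; ↭-reflexive; ↭⇒↭ₛ)
open import Data.List.Relation.Binary.Permutation.Propositional.Properties using (↭-length; ∈-resp-↭; filter-↭; map⁺)
import Data.List.Relation.Binary.Permutation.Setoid.Properties as ↭ₛ
open import Data.List.Relation.Binary.Sublist.Propositional using (lookup; ⊆-refl)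
open import Data.List.Relation.Binary.Sublist.Propositional.Properties using (take-⊆; drop-⊆; filter⁺; length-mono-≤)
open import Data.List.Relation.Unary.All as All using (All; []; _∷_)
import Data.List.Relation.Unary.All.Properties as Allₚ
open import Data.List.Relation.Unary.AllPairs as AllPairs using (AllPairs; []; _∷_)
open import Data.List.Relation.Unary.Any as Any using (here; there)
open import Data.List.Relation.Unary.Sorted.TotalOrder.Properties using (Sorted⇒AllPairs)
open import Data.List.Relation.Unary.Unique.Propositional using (Unique)
import Data.List.Relation.Unary.Unique.Propositional.Properties as Unique
open import Data.Nat
open import Data.Nat.Properties
open import Algebra.Properties.CommutativeSemigroup +-commutativeSemigroup using (x∙yz≈y∙xz)
open import Data.List.Sort ≤-decTotalOrder using (sort; sort-↭; sort-↗)
open import Data.Product using (∃; ∃₂; _×_; _,_; proj₁; proj₂)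
open import Data.Sum using (_⊎_; inj₁; inj₂; [_,_]′)
open import Function using (_∘_; id)
open import Function.Bundles using (_⇔_; mk⇔; Equivalence)
open import Relation.Binary.Bundles using (DecTotalOrder)
open import Relation.Binary.Construct.Closure.ReflexiveTransitive using (Star; ε; _◅_; _◅◅_)
open import Relation.Binary.Definitions using (tri<; tri≈; tri>)
open import Relation.Binary.PropositionalEquality hiding ([_])
open import Relation.Nullary using (¬_; Dec; yes; no)
open import Relation.Unary using (Decidable)

-- Runs of bootstrap percolation

infix 4 _⊑_ _⇒ᵇ_

_⊑_ : Config → Config → Set
m ⊑ m′ = ∀ r c → m r c ≡ true → m′ r c ≡ true

_⇒ᵇ_ : Bool → Bool → Set
a ⇒ᵇ b = a ≡ true → b ≡ true

⊑-refl : ∀ {m} → m ⊑ m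
⊑-refl _ _ on = on

AllOnes : ℕ → Config → Set
AllOnes N m = ∀ r c → r < N → c < N → m r c ≡ true

≡ᵇ-refl : ∀ n → (n ≡ᵇ n) ≡ true
≡ᵇ-refl n = Equivalence.to T-≡ (≡⇒≡ᵇ n n refl)

≡ᵇ-true⇒≡ : ∀ m n → (m ≡ᵇ n) ≡ true → m ≡ n
≡ᵇ-true⇒≡ m n eq = ≡ᵇ⇒≡ m n (Equivalence.from T-≡ eq)

set1-on : ∀ m r c → set1 m r c r c ≡ true
set1-on m r c rewrite ≡ᵇ-refl r | ≡ᵇ-refl c = refl

⊑-set1 : ∀ m r c → m ⊑ set1 m r c
⊑-set1 m r c r′ c′ on with r ≡ᵇ r′ | c ≡ᵇ c′
... | true  | true  = refl
... | true  | false = on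
... | false | _     = on

set1-on⁻ : ∀ m r c r′ c′ → set1 m r c r′ c′ ≡ true → (r ≡ r′ × c ≡ c′) ⊎ m r′ c′ ≡ true
set1-on⁻ m r c r′ c′ on with r ≡ᵇ r′ in eq-r | c ≡ᵇ c′ in eq-c
... | true  | true  = inj₁ (≡ᵇ-true⇒≡ r r′ eq-r , ≡ᵇ-true⇒≡ c c′ eq-c)
... | true  | false = inj₂ on
... | false | _     = inj₂ on

Star-⊑ : ∀ {N m m′} → Star (Step N) m m′ → m ⊑ m′
Star-⊑ ε r c on = on
Star-⊑ {m = m} (mutate r₀ c₀ _ _ _ _ ◅ run) r c on = Star-⊑ run r c (⊑-set1 m r₀ c₀ r c on)

Reach : ℕ → Config → (Config → Set) → Set
Reach N M P = ∃ λ M′ → Star (Step N) M M′ × P M′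

stay : ∀ {N M} {P : Config → Set} → P M → Reach N M P
stay p = _ , ε , p

infixl 1 _>>=_

_>>=_ : ∀ {N M} {P Q : Config → Set} →
        Reach N M P → (∀ {M′} → M ⊑ M′ → P M′ → Reach N M′ Q) → Reach N M Q
(M′ , run , p) >>= f with f (Star-⊑ run) p
... | M″ , run′ , q = M″ , run ◅◅ run′ , q

switchOn : ∀ {N M} R C → R < N → C < N → (M R C ≡ false → 2 ≤ nbCount M R C) →
           Reach N M (λ M′ → M′ R C ≡ true)
switchOn {M = M} R C R<N C<N mutable with M R C in off
... | true  = stay off
... | false = set1 M R C , mutate R C R<N C<N off (mutable refl) ◅ ε , set1-on M R C

b2n-mono : ∀ {a b} → a ⇒ᵇ b → b2n a ≤ b2n b
b2n-mono {false} _   = z≤n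
b2n-mono {true}  a⇒b rewrite a⇒b refl = ≤-refl

b2n-sum-mono : ∀ {a b c d a′ b′ c′ d′} → a ⇒ᵇ a′ → b ⇒ᵇ b′ → c ⇒ᵇ c′ → d ⇒ᵇ d′ →
              b2n a + b2n b + b2n c + b2n d ≤ b2n a′ + b2n b′ + b2n c′ + b2n d′
b2n-sum-mono p q r s = +-mono-≤ (+-mono-≤ (+-mono-≤ (b2n-mono p) (b2n-mono q)) (b2n-mono r)) (b2n-mono s)

nbCount-down-right : ∀ M R C → M (suc R) C ≡ true → M R (suc C) ≡ true → 2 ≤ nbCount M R C
nbCount-down-right M R C down right rewrite down | right =
  two (if R ≡ᵇ 0 then false else M (pred R) C) (if C ≡ᵇ 0 then false else M R (pred C))
  where
  two : ∀ a b → 2 ≤ b2n a + 1 + b2n b + 1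
  two false false = ≤-refl
  two false true  = s≤s (s≤s z≤n)
  two true  false = s≤s (s≤s z≤n)
  two true  true  = s≤s (s≤s z≤n)

nbCount-up-left : ∀ M R C → M R (suc C) ≡ true → M (suc R) C ≡ true → 2 ≤ nbCount M (suc R) (suc C)
nbCount-up-left M R C up left rewrite up | left = two (M (suc (suc R)) (suc C)) (M (suc R) (suc (suc C)))
  where
  two : ∀ a b → 2 ≤ 1 + b2n a + 1 + b2n b
  two false false = ≤-refl
  two false true  = s≤s (s≤s z≤n)
  two true  false = s≤s (s≤s z≤n)
  two true  true  = s≤s (s≤s z≤n)

≥2⇒up⊎left⊎down×right : ∀ u d l r → 2 ≤ b2n u + b2n d + b2n l + b2n r →
                         u ≡ true ⊎ l ≡ true ⊎ (d ≡ true × r ≡ true)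
≥2⇒up⊎left⊎down×right true  _     _     _     _ = inj₁ refl
≥2⇒up⊎left⊎down×right false _     true  _     _ = inj₂ (inj₁ refl)
≥2⇒up⊎left⊎down×right false true  false true  _ = inj₂ (inj₂ (refl , refl))
≥2⇒up⊎left⊎down×right false true  false false (s≤s ())
≥2⇒up⊎left⊎down×right false false false true  (s≤s ())
≥2⇒up⊎left⊎down×right false false false false ()

≥2⇒down⊎right⊎up×left : ∀ u d l r → 2 ≤ b2n u + b2n d + b2n l + b2n r →
                         d ≡ true ⊎ r ≡ true ⊎ (u ≡ true × l ≡ true)
≥2⇒down⊎right⊎up×left _     true  _     _     _ = inj₁ refl
≥2⇒down⊎right⊎up×left _     false _     true  _ = inj₂ (inj₁ refl)
≥2⇒down⊎right⊎up×left true  false true  false _ = inj₂ (inj₂ (refl , refl))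
≥2⇒down⊎right⊎up×left true  false false false (s≤s ())
≥2⇒down⊎right⊎up×left false false true  false (s≤s ())
≥2⇒down⊎right⊎up×left false false false false ()

-- Shifting a run into a larger grid

Shifted : ℕ → ℕ → Config → Config → Set
Shifted dr dc m M = ∀ x y → m x y ≡ true → M (dr + x) (dc + y) ≡ true

nbCount-shift : ∀ {m M} dr dc x y → Shifted dr dc m M → nbCount m x y ≤ nbCount M (dr + x) (dc + y)
nbCount-shift {m} {M} dr dc x y m↪M = b2n-sum-mono (up x) down (left y) right
  where
  up : ∀ x → (if x ≡ᵇ 0 then false else m (pred x) y)
             ⇒ᵇ (if dr + x ≡ᵇ 0 then false else M (pred (dr + x)) (dc + y))
  up zero ()
  up (suc x) on rewrite +-suc dr x = m↪M x y on
  left : ∀ y → (if y ≡ᵇ 0 then false else m x (pred y))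
               ⇒ᵇ (if dc + y ≡ᵇ 0 then false else M (dr + x) (pred (dc + y)))
  left zero ()
  left (suc y) on rewrite +-suc dc y = m↪M x y on
  down : m (suc x) y ⇒ᵇ M (suc (dr + x)) (dc + y)
  down on = subst (λ r → M r (dc + y) ≡ true) (+-suc dr x) (m↪M (suc x) y on)
  right : m x (suc y) ⇒ᵇ M (dr + x) (suc (dc + y))
  right on = subst (λ c → M (dr + x) c ≡ true) (+-suc dc y) (m↪M x (suc y) on)

Shifted-set1 : ∀ {m M M′ x y} dr dc → Shifted dr dc m M → M ⊑ M′ → M′ (dr + x) (dc + y) ≡ true →
               Shifted dr dc (set1 m x y) M′
Shifted-set1 {m} {x = x} {y} dr dc m↪M M⊑M′ on x′ y′ on′ =
  [ (λ { (refl , refl) → on }) , (λ old → M⊑M′ _ _ (m↪M x′ y′ old)) ]′ (set1-on⁻ m x y x′ y′ on′)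

shiftRun : ∀ {s N m m′ M} dr dc → dr + s ≤ N → dc + s ≤ N →
           Star (Step s) m m′ → Shifted dr dc m M → Reach N M (Shifted dr dc m′)
shiftRun dr dc _ _ ε m↪M = stay m↪M
shiftRun {M = M} dr dc dr+s≤N dc+s≤N (mutate x y x<s y<s _ mutable ◅ run) m↪M =
  switchOn (dr + x) (dc + y) (<-≤-trans (+-monoʳ-< dr x<s) dr+s≤N) (<-≤-trans (+-monoʳ-< dc y<s) dc+s≤N)
           (λ _ → ≤-trans mutable (nbCount-shift {M = M} dr dc x y m↪M)) >>= λ M⊑M′ on →
  shiftRun dr dc dr+s≤N dc+s≤N run (Shifted-set1 dr dc m↪M M⊑M′ on)

-- Filling rectangles

∀<suc : ∀ {P : ℕ → Set} {n} → (∀ i → i < n → P i) → P n → ∀ i → i < suc n → P i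
∀<suc below pn i i<1+n with m<1+n⇒m<n∨m≡n i<1+n
... | inj₁ i<n  = below i i<n
... | inj₂ refl = pn

fillRowLeftward : ∀ {N M} r w → r < N → w ≤ N →
                  (∀ j → j < w → M (suc r) j ≡ true) → M r w ≡ true →
                  Reach N M (λ M′ → ∀ j → j < w → M′ r j ≡ true)
fillRowLeftward r zero _ _ _ _ = stay λ _ ()
fillRowLeftward {M = M} r (suc w) r<N w<N below right =
  switchOn r w r<N w<N (λ _ → nbCount-down-right M r w (below w ≤-refl) right) >>= λ M⊑M₁ on →
  fillRowLeftward r w r<N (<⇒≤ w<N) (λ j j<w → M⊑M₁ _ _ (below j (m<n⇒m<1+n j<w))) on >>= λ M₁⊑M₂ row →
  stay (∀<suc row (M₁⊑M₂ _ _ on))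

fillRectLeftUp : ∀ {N M} h w → h ≤ N → w ≤ N →
                 (∀ j → j < w → M h j ≡ true) → (∀ i → i < h → M i w ≡ true) →
                 Reach N M (λ M′ → ∀ i → i < h → ∀ j → j < w → M′ i j ≡ true)
fillRectLeftUp zero _ _ _ _ _ = stay λ _ ()
fillRectLeftUp (suc h) w h<N w≤N below right =
  fillRowLeftward h w h<N w≤N below (right h ≤-refl) >>= λ M⊑M₁ row →
  fillRectLeftUp h w (<⇒≤ h<N) w≤N row (λ i i<h → M⊑M₁ _ _ (right i (m<n⇒m<1+n i<h))) >>= λ M₁⊑M₂ rect →
  stay (∀<suc rect (λ j j<w → M₁⊑M₂ _ _ (row j j<w)))

prefix-end : ∀ {P : ℕ → Set} b w → P b → (∀ j → j < w → P (suc (b + j))) → P (b + w)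
prefix-end {P} b zero    pb _   = subst P (sym (+-identityʳ b)) pb
prefix-end {P} b (suc w) _  pre = subst P (sym (+-suc b w)) (pre w ≤-refl)

fillRowRightward : ∀ {N M} u b w → suc u < N → b + w < N →
                   (∀ j → j < w → M u (suc (b + j)) ≡ true) → M (suc u) b ≡ true →
                   Reach N M (λ M′ → ∀ j → j < w → M′ (suc u) (suc (b + j)) ≡ true)
fillRowRightward u b zero _ _ _ _ = stay λ _ ()
fillRowRightward {N} u b (suc w) u<N b+w<N above left =
  fillRowRightward u b w u<N (<-trans (+-monoʳ-< b (n<1+n w)) b+w<N)
                   (λ j j<w → above j (m<n⇒m<1+n j<w)) left >>= λ {M₁} M⊑M₁ row →
  switchOn (suc u) (suc (b + w)) u<N (subst (_< N) (+-suc b w) b+w<N)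
           (λ _ → nbCount-up-left M₁ u (b + w) (M⊑M₁ _ _ (above w ≤-refl))
                    (prefix-end {λ c → M₁ (suc u) c ≡ true} b w (M⊑M₁ _ _ left) row)) >>= λ M₁⊑M₂ on →
  stay (∀<suc (λ j j<w → M₁⊑M₂ _ _ (row j j<w)) on)

fillRectRightDown : ∀ {N M} a b h w → a + h < N → b + w < N →
                    (∀ j → j < w → M a (suc (b + j)) ≡ true) →
                    (∀ i → i < h → M (suc (a + i)) b ≡ true) →
                    Reach N M (λ M′ → ∀ i → i < h → ∀ j → j < w → M′ (suc (a + i)) (suc (b + j)) ≡ true)
fillRectRightDown a b zero _ _ _ _ _ = stay λ _ ()
fillRectRightDown {N} a b (suc h) w a+h<N b+w<N above left =
  fillRectRightDown a b h w (<-trans (+-monoʳ-< a (n<1+n h)) a+h<N) b+w<N above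
                    (λ i i<h → left i (m<n⇒m<1+n i<h)) >>= λ {M₁} M⊑M₁ rect →
  fillRowRightward (a + h) b w (subst (_< N) (+-suc a h) a+h<N) b+w<N
                   (prefix-end {λ r → ∀ j → j < w → M₁ r (suc (b + j)) ≡ true} a h
                               (λ j j<w → M⊑M₁ _ _ (above j j<w)) rect)
                   (M⊑M₁ _ _ (left h ≤-refl)) >>= λ M₁⊑M₂ row →
  stay (∀<suc (λ i i<h j j<w → M₁⊑M₂ _ _ (rect i i<h j j<w)) row)

-- Direct sums

on≢off : ∀ {b} → b ≡ true → b ≡ false → ⊥
on≢off refl ()

data Offset (a : ℕ) : ℕ → Set where
  inside : ∀ {R} → R < a → Offset a R
  beyond : ∀ x → Offset a (a + x)

offset : ∀ a R → Offset a R
offset a R with R <? a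
... | yes R<a = inside R<a
... | no  R≮a = subst (Offset a) (m+[n∸m]≡n (≮⇒≥ R≮a)) (beyond (R ∸ a))

<⇒≢+ : ∀ {a R} x → R < a → R ≢ a + x
<⇒≢+ {a} x R<a refl = m+n≮m a x R<a

upward-closure : ∀ {P : ℕ → Set} {a b} → P a → (∀ i → suc a ≤ i → i < b → P i) → ∀ i → a ≤ i → i < b → P i
upward-closure pa above i a≤i i<b with m≤n⇒m<n∨m≡n a≤i
... | inj₁ a<i  = above i a<i i<b
... | inj₂ refl = pa

downward-closure : ∀ {P : ℕ → Set} {a} → P a → (∀ i → i < a → P i) → ∀ i → i ≤ a → P i
downward-closure pa below i i≤a = ∀<suc below pa i (s≤s i≤a)

module DirectSum (k′ l′ : ℕ) where

  -- Rows are counted from the top, so in the matrix of b ⊕ c (with |b| = k, |c| = l) the matrix of b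
  -- is the bottom-left block of rows l + x, columns y < k, and that of c the top-right block of rows
  -- r < l, columns k + y.
  k l n : ℕ
  k = suc k′
  l = suc l′
  n = k + l

  l+x<n : ∀ {x} → x < k → l + x < n
  l+x<n {x} x<k = subst (l + x <_) (+-comm l k) (+-monoʳ-< l x<k)

  k+y<n : ∀ {y} → y < l → k + y < n
  k+y<n = +-monoʳ-< k

  l≤n : l ≤ n
  l≤n = m≤n+m l k

  k≤n : k ≤ n
  k≤n = m≤m+n k l

  l+x<n⁻ : ∀ x → l + x < n → x < k
  l+x<n⁻ x l+x<n = +-cancelˡ-< l x k (subst (l + x <_) (+-comm k l) l+x<n)

  k+y<n⁻ : ∀ y → k + y < n → y < l
  k+y<n⁻ y = +-cancelˡ-< k y l

  l′+0<l : l′ + 0 < l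
  l′+0<l = s≤s (≤-reflexive (+-identityʳ l′))

  k′+0<k : k′ + 0 < k
  k′+0<k = s≤s (≤-reflexive (+-identityʳ k′))

  SupportedTL : Config → Config → ℕ → ℕ → Set
  SupportedTL mb mc r c = (∀ c′ → c ≤ c′ → c′ < k → mb 0 c′ ≡ true) ×
                          (∀ r′ → r ≤ r′ → r′ < l → mc r′ 0 ≡ true)

  SupportedBR : Config → Config → ℕ → ℕ → Set
  SupportedBR mb mc x y = (∀ x′ → x′ ≤ x → mb x′ k′ ≡ true) ×
                          (∀ y′ → y′ ≤ y → mc l′ y′ ≡ true)

  SupportedTL-weaken : ∀ {mb mc r c r₁ c₁} → r ≤ r₁ → c ≤ c₁ →
                       SupportedTL mb mc r c → SupportedTL mb mc r₁ c₁
  SupportedTL-weaken r≤r₁ c≤c₁ (cols , rows) =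
    (λ c′ c₁≤c′ → cols c′ (≤-trans c≤c₁ c₁≤c′)) , (λ r′ r₁≤r′ → rows r′ (≤-trans r≤r₁ r₁≤r′))

  SupportedBR-weaken : ∀ {mb mc x y x₁ y₁} → x₁ ≤ x → y₁ ≤ y →
                       SupportedBR mb mc x y → SupportedBR mb mc x₁ y₁
  SupportedBR-weaken x₁≤x y₁≤y (rows , cols) =
    (λ x′ x′≤x₁ → rows x′ (≤-trans x′≤x₁ x₁≤x)) , (λ y′ y′≤y₁ → cols y′ (≤-trans y′≤y₁ y₁≤y))

  SupportedTL-mono : ∀ {mb mc mb′ mc′ r c} → mb ⊑ mb′ → mc ⊑ mc′ →
                     SupportedTL mb mc r c → SupportedTL mb′ mc′ r c
  SupportedTL-mono mb⊑ mc⊑ (cols , rows) =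
    (λ c′ c≤c′ c′<k → mb⊑ _ _ (cols c′ c≤c′ c′<k)) , (λ r′ r≤r′ r′<l → mc⊑ _ _ (rows r′ r≤r′ r′<l))

  SupportedBR-mono : ∀ {mb mc mb′ mc′ x y} → mb ⊑ mb′ → mc ⊑ mc′ →
                     SupportedBR mb mc x y → SupportedBR mb′ mc′ x y
  SupportedBR-mono mb⊑ mc⊑ (rows , cols) =
    (λ x′ x′≤x → mb⊑ _ _ (rows x′ x′≤x)) , (λ y′ y′≤y → mc⊑ _ _ (cols y′ y′≤y))

  record Admissible (mb mc : Config) (R C : ℕ) : Set where
    field
      row<n  : R < n
      col<n  : C < n
      onBL   : ∀ x → R ≡ l + x → C < k → mb x C ≡ true
      onTR   : ∀ y → R < l → C ≡ k + y → mc R y ≡ true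
      suppTL : R < l → C < k → SupportedTL mb mc R C
      suppBR : ∀ x y → R ≡ l + x → C ≡ k + y → SupportedBR mb mc x y
  open Admissible

  Covered : Config → Config → Config → Set
  Covered M mb mc = ∀ R C → M R C ≡ true → Admissible mb mc R C

  Admissible-mono : ∀ {mb mc mb′ mc′ R C} → mb ⊑ mb′ → mc ⊑ mc′ →
                    Admissible mb mc R C → Admissible mb′ mc′ R C
  Admissible-mono mb⊑ mc⊑ adm = record
    { row<n  = row<n adm
    ; col<n  = col<n adm
    ; onBL   = λ x R≡ C<k → mb⊑ _ _ (onBL adm x R≡ C<k)
    ; onTR   = λ y R<l C≡ → mc⊑ _ _ (onTR adm y R<l C≡)
    ; suppTL = λ R<l C<k → SupportedTL-mono mb⊑ mc⊑ (suppTL adm R<l C<k)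
    ; suppBR = λ x y R≡ C≡ → SupportedBR-mono mb⊑ mc⊑ (suppBR adm x y R≡ C≡)
    }

  Covered-mono : ∀ {M mb mc mb′ mc′} → mb ⊑ mb′ → mc ⊑ mc′ → Covered M mb mc → Covered M mb′ mc′
  Covered-mono mb⊑ mc⊑ cov R C on = Admissible-mono mb⊑ mc⊑ (cov R C on)

  Covered-set1 : ∀ {M mb mc R C} → Covered M mb mc → Admissible mb mc R C → Covered (set1 M R C) mb mc
  Covered-set1 {M} {R = R} {C} cov adm R′ C′ on =
    [ (λ { (refl , refl) → adm }) , cov R′ C′ ]′ (set1-on⁻ M R C R′ C′ on)

  admissibleTL : ∀ {mb mc R C} → R < l → C < k → SupportedTL mb mc R C → Admissible mb mc R C
  admissibleTL R<l C<k supp = record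
    { row<n  = <-≤-trans R<l l≤n
    ; col<n  = <-≤-trans C<k k≤n
    ; onBL   = λ x R≡ _ → ⊥-elim (<⇒≢+ x R<l R≡)
    ; onTR   = λ y _ C≡ → ⊥-elim (<⇒≢+ y C<k C≡)
    ; suppTL = λ _ _ → supp
    ; suppBR = λ x _ R≡ _ → ⊥-elim (<⇒≢+ x R<l R≡)
    }

  admissibleBL : ∀ {mb mc x C} → x < k → C < k → mb x C ≡ true → Admissible mb mc (l + x) C
  admissibleBL {mb} {x = x} {C} x<k C<k on = record
    { row<n  = l+x<n x<k
    ; col<n  = <-≤-trans C<k k≤n
    ; onBL   = λ x′ l+x≡ _ → subst (λ x″ → mb x″ C ≡ true) (+-cancelˡ-≡ l x x′ l+x≡) on
    ; onTR   = λ _ l+x<l _ → ⊥-elim (<⇒≢+ x l+x<l refl)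
    ; suppTL = λ l+x<l _ → ⊥-elim (<⇒≢+ x l+x<l refl)
    ; suppBR = λ _ y _ C≡ → ⊥-elim (<⇒≢+ y C<k C≡)
    }

  admissibleTR : ∀ {mb mc R y} → R < l → y < l → mc R y ≡ true → Admissible mb mc R (k + y)
  admissibleTR {mc = mc} {R} {y} R<l y<l on = record
    { row<n  = <-≤-trans R<l l≤n
    ; col<n  = k+y<n y<l
    ; onBL   = λ x R≡ _ → ⊥-elim (<⇒≢+ x R<l R≡)
    ; onTR   = λ y′ _ k+y≡ → subst (λ y″ → mc R y″ ≡ true) (+-cancelˡ-≡ k y y′ k+y≡) on
    ; suppTL = λ _ k+y<k → ⊥-elim (<⇒≢+ y k+y<k refl)
    ; suppBR = λ x _ R≡ _ → ⊥-elim (<⇒≢+ x R<l R≡)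
    }

  admissibleBR : ∀ {mb mc x y} → x < k → y < l → SupportedBR mb mc x y → Admissible mb mc (l + x) (k + y)
  admissibleBR {mb} {mc} {x} {y} x<k y<l supp = record
    { row<n  = l+x<n x<k
    ; col<n  = k+y<n y<l
    ; onBL   = λ _ _ k+y<k → ⊥-elim (<⇒≢+ y k+y<k refl)
    ; onTR   = λ _ l+x<l _ → ⊥-elim (<⇒≢+ x l+x<l refl)
    ; suppTL = λ l+x<l _ → ⊥-elim (<⇒≢+ x l+x<l refl)
    ; suppBR = λ x′ y′ l+x≡ k+y≡ →
        subst₂ (SupportedBR mb mc) (+-cancelˡ-≡ l x x′ l+x≡) (+-cancelˡ-≡ k y y′ k+y≡) supp
    }

  Projection : Config → Config → Config → Set
  Projection M mb mc = ∃₂ λ mb′ mc′ → Star (Step k) mb mb′ × Star (Step l) mc mc′ × Covered M mb′ mc′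

  module _ {M mb mc : Config} (cov : Covered M mb mc) where

    onBL⇒ : ∀ x y → y < k → M (l + x) y ≡ true → mb x y ≡ true
    onBL⇒ x y y<k on = onBL (cov _ _ on) x refl y<k

    onTR⇒ : ∀ r y → r < l → M r (k + y) ≡ true → mc r y ≡ true
    onTR⇒ r y r<l on = onTR (cov _ _ on) y r<l refl

    onTL⇒ : ∀ r c → r < l → c < k → M r c ≡ true → SupportedTL mb mc r c
    onTL⇒ r c r<l c<k on = suppTL (cov _ _ on) r<l c<k

    onBR⇒ : ∀ x y → M (l + x) (k + y) ≡ true → SupportedBR mb mc x y
    onBR⇒ x y on = suppBR (cov _ _ on) x y refl refl

    next-row : ∀ x C → x < k → M (suc (l + x)) C ≡ true → suc x < k × M (l + suc x) C ≡ true
    next-row x C x<k on with m≤n⇒m<n∨m≡n x<k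
    ... | inj₁ 1+x<k = 1+x<k , subst (λ r → M r C ≡ true) (sym (+-suc l x)) on
    ... | inj₂ refl  = ⊥-elim (<-irrefl (trans (sym (+-suc l k′)) (+-comm l k)) (row<n (cov _ _ on)))

    next-col : ∀ R y → y < l → M R (suc (k + y)) ≡ true → suc y < l × M R (k + suc y) ≡ true
    next-col R y y<l on with m≤n⇒m<n∨m≡n y<l
    ... | inj₁ 1+y<l = 1+y<l , subst (λ c → M R c ≡ true) (sym (+-suc k y)) on
    ... | inj₂ refl  = ⊥-elim (<-irrefl (sym (+-suc k l′)) (col<n (cov _ _ on)))

    -- An occupied neighbour of a b- or c-cell in one of the empty blocks forces that cell itself to be
    -- occupied in mb or mc, so it never counts towards a cell that is still off there.
    up-BL : ∀ x y → y < k → mb x y ≡ false →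
            M (l′ + x) y ⇒ᵇ (if x ≡ᵇ 0 then false else mb (pred x) y)
    up-BL zero    y y<k off on =
      ⊥-elim (on≢off (proj₁ (onTL⇒ (l′ + 0) y l′+0<l y<k on) y ≤-refl y<k) off)
    up-BL (suc x) y y<k _   on = onBL⇒ x y y<k (subst (λ r → M r y ≡ true) (+-suc l′ x) on)

    right-BL : ∀ x y → y < k → mb x y ≡ false → M (l + x) (suc y) ⇒ᵇ mb x (suc y)
    right-BL x y y<k off on with m≤n⇒m<n∨m≡n y<k
    ... | inj₁ 1+y<k = onBL⇒ x (suc y) 1+y<k on
    ... | inj₂ refl  =
      ⊥-elim (on≢off (proj₁ (onBR⇒ x 0 (subst (λ c → M (l + x) c ≡ true) (sym (+-identityʳ k)) on)) x ≤-refl) off)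

    nbCount-BL : ∀ x y → x < k → y < k → mb x y ≡ false → nbCount M (l + x) y ≤ nbCount mb x y
    nbCount-BL x y x<k y<k off = b2n-sum-mono (up-BL x y y<k off) down (left y y<k) (right-BL x y y<k off)
      where
      down : M (suc (l + x)) y ⇒ᵇ mb (suc x) y
      down on = onBL⇒ (suc x) y y<k (proj₂ (next-row x y x<k on))
      left : ∀ y → y < k → (if y ≡ᵇ 0 then false else M (l + x) (pred y))
                           ⇒ᵇ (if y ≡ᵇ 0 then false else mb x (pred y))
      left zero    _     ()
      left (suc y) 1+y<k on = onBL⇒ x y (<-trans (n<1+n y) 1+y<k) on

    down-TR : ∀ r y → r < l → mc r y ≡ false → M (suc r) (k + y) ⇒ᵇ mc (suc r) y
    down-TR r y r<l off on with m≤n⇒m<n∨m≡n r<l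
    ... | inj₁ 1+r<l = onTR⇒ (suc r) y 1+r<l on
    ... | inj₂ refl  =
      ⊥-elim (on≢off (proj₂ (onBR⇒ 0 y (subst (λ r → M r (k + y) ≡ true) (sym (+-identityʳ l)) on)) y ≤-refl) off)

    left-TR : ∀ r y → r < l → mc r y ≡ false →
              M r (k′ + y) ⇒ᵇ (if y ≡ᵇ 0 then false else mc r (pred y))
    left-TR r zero    r<l off on =
      ⊥-elim (on≢off (proj₂ (onTL⇒ r (k′ + 0) r<l k′+0<k on) r ≤-refl r<l) off)
    left-TR r (suc y) r<l _   on = onTR⇒ r y r<l (subst (λ c → M r c ≡ true) (+-suc k′ y) on)

    nbCount-TR : ∀ r y → r < l → y < l → mc r y ≡ false → nbCount M r (k + y) ≤ nbCount mc r y
    nbCount-TR r y r<l y<l off = b2n-sum-mono (up r r<l) (down-TR r y r<l off) (left-TR r y r<l off) right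
      where
      up : ∀ r → r < l → (if r ≡ᵇ 0 then false else M (pred r) (k + y))
                         ⇒ᵇ (if r ≡ᵇ 0 then false else mc (pred r) y)
      up zero    _     ()
      up (suc r) 1+r<l on = onTR⇒ r y (<-trans (n<1+n r) 1+r<l) on
      right : M r (suc (k + y)) ⇒ᵇ mc r (suc y)
      right on = onTR⇒ r (suc y) r<l (proj₂ (next-col r y y<l on))

    below-supportsTL : ∀ R C → R < l → C < k → M (suc R) C ≡ true →
                       mb 0 C ≡ true × (∀ r′ → suc R ≤ r′ → r′ < l → mc r′ 0 ≡ true)
    below-supportsTL R C R<l C<k on with m≤n⇒m<n∨m≡n R<l
    ... | inj₁ 1+R<l = let (cols , rows) = onTL⇒ (suc R) C 1+R<l C<k on in cols C ≤-refl C<k , rows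
    ... | inj₂ refl  = onBL⇒ 0 C C<k (subst (λ r → M r C ≡ true) (sym (+-identityʳ l)) on) ,
                       λ r′ l≤r′ r′<l → ⊥-elim (<⇒≱ r′<l l≤r′)

    right-supportsTL : ∀ R C → R < l → C < k → M R (suc C) ≡ true →
                       mc R 0 ≡ true × (∀ c′ → suc C ≤ c′ → c′ < k → mb 0 c′ ≡ true)
    right-supportsTL R C R<l C<k on with m≤n⇒m<n∨m≡n C<k
    ... | inj₁ 1+C<k = let (cols , rows) = onTL⇒ R (suc C) R<l 1+C<k on in rows R ≤-refl R<l , cols
    ... | inj₂ refl  = onTR⇒ R 0 R<l (subst (λ c → M R c ≡ true) (sym (+-identityʳ k)) on) ,
                       λ c′ k≤c′ c′<k → ⊥-elim (<⇒≱ c′<k k≤c′)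

    supportedTL-new : ∀ R C → R < l → C < k → 2 ≤ nbCount M R C → SupportedTL mb mc R C
    supportedTL-new R C R<l C<k mutable with ≥2⇒up⊎left⊎down×right _ _ _ _ mutable
    ... | inj₁ up-on         = from-up R R<l up-on
      where
      from-up : ∀ R → R < l → (if R ≡ᵇ 0 then false else M (pred R) C) ≡ true → SupportedTL mb mc R C
      from-up zero    _     ()
      from-up (suc R) 1+R<l on =
        SupportedTL-weaken {mb} {mc} (n≤1+n R) ≤-refl (onTL⇒ R C (<-trans (n<1+n R) 1+R<l) C<k on)
    ... | inj₂ (inj₁ left-on) = from-left C C<k left-on
      where
      from-left : ∀ C → C < k → (if C ≡ᵇ 0 then false else M R (pred C)) ≡ true → SupportedTL mb mc R C
      from-left zero    _     ()
      from-left (suc C) 1+C<k on =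
        SupportedTL-weaken {mb} {mc} ≤-refl (n≤1+n C) (onTL⇒ R C R<l (<-trans (n<1+n C) 1+C<k) on)
    ... | inj₂ (inj₂ (down-on , right-on)) =
      let (col₀ , rows-below) = below-supportsTL R C R<l C<k down-on
          (row₀ , cols-right) = right-supportsTL R C R<l C<k right-on
      in upward-closure col₀ cols-right , upward-closure row₀ rows-below

    above-supportsBR : ∀ x y → M (l′ + x) (k + y) ≡ true → mc l′ y ≡ true × (∀ x′ → x′ < x → mb x′ k′ ≡ true)
    above-supportsBR zero    y on =
      subst (λ r → mc r y ≡ true) (+-identityʳ l′) (onTR⇒ (l′ + 0) y l′+0<l on) , λ _ ()
    above-supportsBR (suc x) y on =
      let (rows , cols) = onBR⇒ x y (subst (λ r → M r (k + y) ≡ true) (+-suc l′ x) on)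
      in cols y ≤-refl , λ x′ x′<1+x → rows x′ (≤-pred x′<1+x)

    left-supportsBR : ∀ x y → M (l + x) (k′ + y) ≡ true → mb x k′ ≡ true × (∀ y′ → y′ < y → mc l′ y′ ≡ true)
    left-supportsBR x zero    on =
      subst (λ c → mb x c ≡ true) (+-identityʳ k′) (onBL⇒ x (k′ + 0) k′+0<k on) , λ _ ()
    left-supportsBR x (suc y) on =
      let (rows , cols) = onBR⇒ x y (subst (λ c → M (l + x) c ≡ true) (+-suc k′ y) on)
      in rows x ≤-refl , λ y′ y′<1+y → cols y′ (≤-pred y′<1+y)

    supportedBR-new : ∀ x y → x < k → y < l → 2 ≤ nbCount M (l + x) (k + y) → SupportedBR mb mc x y
    supportedBR-new x y x<k y<l mutable with ≥2⇒down⊎right⊎up×left _ _ _ _ mutable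
    ... | inj₁ down-on =
      SupportedBR-weaken {mb} {mc} (n≤1+n x) ≤-refl (onBR⇒ (suc x) y (proj₂ (next-row x (k + y) x<k down-on)))
    ... | inj₂ (inj₁ right-on) =
      SupportedBR-weaken {mb} {mc} ≤-refl (n≤1+n y) (onBR⇒ x (suc y) (proj₂ (next-col (l + x) y y<l right-on)))
    ... | inj₂ (inj₂ (up-on , left-on)) =
      let (col₀ , rows-above) = above-supportsBR x y up-on
          (row₀ , cols-left)  = left-supportsBR x y left-on
      in downward-closure row₀ rows-above , downward-closure col₀ cols-left

    project-TL : ∀ R C → R < l → C < k → 2 ≤ nbCount M R C → Projection (set1 M R C) mb mc
    project-TL R C R<l C<k mutable =
      mb , mc , ε , ε , Covered-set1 cov (admissibleTL R<l C<k (supportedTL-new R C R<l C<k mutable))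

    project-TR : ∀ R y → R < l → y < l → 2 ≤ nbCount M R (k + y) → Projection (set1 M R (k + y)) mb mc
    project-TR R y R<l y<l mutable
      with switchOn {M = mc} R y R<l y<l (λ off → ≤-trans mutable (nbCount-TR R y R<l y<l off))
    ... | mc′ , run , on =
      mb , mc′ , ε , run , Covered-set1 (Covered-mono ⊑-refl (Star-⊑ run) cov) (admissibleTR R<l y<l on)

    project-BL : ∀ x C → x < k → C < k → 2 ≤ nbCount M (l + x) C → Projection (set1 M (l + x) C) mb mc
    project-BL x C x<k C<k mutable
      with switchOn {M = mb} x C x<k C<k (λ off → ≤-trans mutable (nbCount-BL x C x<k C<k off))
    ... | mb′ , run , on =
      mb′ , mc , run , ε , Covered-set1 (Covered-mono (Star-⊑ run) ⊑-refl cov) (admissibleBL x<k C<k on)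

    project-BR : ∀ x y → x < k → y < l → 2 ≤ nbCount M (l + x) (k + y) →
                 Projection (set1 M (l + x) (k + y)) mb mc
    project-BR x y x<k y<l mutable =
      mb , mc , ε , ε , Covered-set1 cov (admissibleBR x<k y<l (supportedBR-new x y x<k y<l mutable))

  project-step : ∀ {M mb mc} R C → R < n → C < n → 2 ≤ nbCount M R C →
                 Covered M mb mc → Projection (set1 M R C) mb mc
  project-step R C R<n C<n mutable cov with offset l R | offset k C
  ... | inside R<l | inside C<k = project-TL cov R C R<l C<k mutable
  ... | inside R<l | beyond y   = project-TR cov R y R<l (k+y<n⁻ y C<n) mutable
  ... | beyond x   | inside C<k = project-BL cov x C (l+x<n⁻ x R<n) C<k mutable
  ... | beyond x   | beyond y   = project-BR cov x y (l+x<n⁻ x R<n) (k+y<n⁻ y C<n) mutable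

  project : ∀ {M M′ mb mc} → Star (Step n) M M′ → Covered M mb mc → Projection M′ mb mc
  project ε cov = _ , _ , ε , ε , cov
  project (mutate R C R<n C<n _ mutable ◅ run) cov with project-step R C R<n C<n mutable cov
  ... | _ , _ , runb₁ , runc₁ , cov₁ with project run cov₁
  ... | mb₂ , mc₂ , runb₂ , runc₂ , cov₂ = mb₂ , mc₂ , runb₁ ◅◅ runb₂ , runc₁ ◅◅ runc₂ , cov₂

  project-full : ∀ {M₀ M mb mc} → Star (Step n) M₀ M → AllOnes n M → Covered M₀ mb mc →
                 Reach k mb (AllOnes k) × Reach l mc (AllOnes l)
  project-full run full cov with project run cov
  ... | mb′ , mc′ , runb , runc , cov′ =
    (mb′ , runb , λ x y x<k y<k → onBL⇒ cov′ x y y<k (full _ _ (l+x<n x<k) (<-≤-trans y<k k≤n))) ,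
    (mc′ , runc , λ r y r<l y<l → onTR⇒ cov′ r y r<l (full _ _ (<-≤-trans r<l l≤n) (k+y<n y<l)))

  fill : ∀ {M} → (∀ x y → x < k → y < k → M (l + x) y ≡ true) →
         (∀ r y → r < l → y < l → M r (k + y) ≡ true) →
         Reach n M (AllOnes n)
  fill {M} bl tr =
    fillRectLeftUp l k l≤n k≤n
      (λ j j<k → subst (λ r → M r j ≡ true) (+-identityʳ l) (bl 0 j z<s j<k))
      (λ i i<l → subst (λ c → M i c ≡ true) (+-identityʳ k) (tr i 0 i<l z<s)) >>= λ M⊑M₁ tl →
    fillRectRightDown l′ k′ k l l′+k<n k′+l<n
      (λ j j<l → M⊑M₁ _ _ (tr l′ j ≤-refl j<l))
      (λ i i<k → M⊑M₁ _ _ (bl i k′ i<k ≤-refl)) >>= λ M₁⊑M₂ br →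
    stay λ R C R<n C<n → everywhere tl br M⊑M₁ M₁⊑M₂ R C R<n C<n
    where
    l′+k<n : l′ + k < n
    l′+k<n = subst (_< n) (+-comm k l′) (+-monoʳ-< k ≤-refl)
    k′+l<n : k′ + l < n
    k′+l<n = +-monoˡ-< l ≤-refl
    everywhere : ∀ {M₁ M₂} → (∀ i → i < l → ∀ j → j < k → M₁ i j ≡ true) →
                 (∀ i → i < k → ∀ j → j < l → M₂ (l + i) (k + j) ≡ true) →
                 M ⊑ M₁ → M₁ ⊑ M₂ → AllOnes n M₂
    everywhere tl br M⊑M₁ M₁⊑M₂ R C R<n C<n with offset l R | offset k C
    ... | inside R<l | inside C<k = M₁⊑M₂ _ _ (tl R R<l C C<k)
    ... | inside R<l | beyond y   = M₁⊑M₂ _ _ (M⊑M₁ _ _ (tr R y R<l (k+y<n⁻ y C<n)))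
    ... | beyond x   | inside C<k = M₁⊑M₂ _ _ (M⊑M₁ _ _ (bl x C (l+x<n⁻ x R<n) C<k))
    ... | beyond x   | beyond y   = br x (l+x<n⁻ x R<n) y (k+y<n⁻ y C<n)

  fill-from-blocks : ∀ {M mb mc} → Shifted l 0 mb M → Shifted 0 k mc M →
                     Reach k mb (AllOnes k) → Reach l mc (AllOnes l) → Reach n M (AllOnes n)
  fill-from-blocks mb↪M mc↪M (_ , runb , fullb) (_ , runc , fullc) =
    shiftRun l 0 (≤-reflexive (+-comm l k)) k≤n runb mb↪M >>= λ M⊑M₁ bl →
    shiftRun 0 k l≤n ≤-refl runc (λ r y on → M⊑M₁ _ _ (mc↪M r y on)) >>= λ M₁⊑M₂ tr →
    fill (λ x y x<k y<k → M₁⊑M₂ _ _ (bl x y (fullb x y x<k y<k)))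
         (λ r y r<l y<l → tr r y (fullc r y r<l y<l))

-- Permutation matrices of direct sums

at-++ˡ : ∀ (b c : List ℕ) i → i < length b → at (b ++ c) i ≡ at b i
at-++ˡ (x ∷ b) c zero    _         = refl
at-++ˡ (x ∷ b) c (suc i) (s≤s i<b) = at-++ˡ b c i i<b

at-++ʳ : ∀ (b c : List ℕ) j → at (b ++ c) (length b + j) ≡ at c j
at-++ʳ []      c j = refl
at-++ʳ (x ∷ b) c j = at-++ʳ b c j

at-map : ∀ f (c : List ℕ) j → j < length c → at (map f c) j ≡ f (at c j)
at-map f (x ∷ c) zero    _         = refl
at-map f (x ∷ c) (suc j) (s≤s j<c) = at-map f c j j<c

at-All : ∀ {P : ℕ → Set} (w : List ℕ) i → All P w → i < length w → P (at w i)
at-All (x ∷ w) zero    (px ∷ _)  _         = px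
at-All (x ∷ w) (suc i) (_  ∷ pw) (s≤s i<w) = at-All w i pw i<w

permMatrix-on⁻ : ∀ w R C → permMatrix w R C ≡ true → C < length w × R + at w C ≡ length w
permMatrix-on⁻ w R C on with C <? length w
... | yes C<w = C<w , ≡ᵇ-true⇒≡ _ _ on

permMatrix-on⁺ : ∀ w R C → C < length w → R + at w C ≡ length w → permMatrix w R C ≡ true
permMatrix-on⁺ w R C C<w eq with C <? length w
... | yes _   rewrite eq = ≡ᵇ-refl (length w)
... | no C≮w = ⊥-elim (C≮w C<w)

infixr 5 _⊕_

_⊕_ : List ℕ → List ℕ → List ℕ
b ⊕ c = b ++ map (length b +_) c

Within : ℕ → List ℕ → Set
Within m w = All (λ x → 1 ≤ x × x ≤ m) w

FullPerm-[] : FullPerm []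
FullPerm-[] = stay λ _ _ ()

module ⊕-Blocks (x₀ z₀ : ℕ) (b′ c′ : List ℕ) where

  open DirectSum (length b′) (length c′)

  b c a : List ℕ
  b = x₀ ∷ b′
  c = z₀ ∷ c′
  a = b ⊕ c

  length-⊕ : length a ≡ n
  length-⊕ = trans (length-++ b) (cong (k +_) (length-map (k +_) c))

  at-⊕ˡ : ∀ y → y < k → at a y ≡ at b y
  at-⊕ˡ y y<k = at-++ˡ b _ y y<k

  at-⊕ʳ : ∀ y → y < l → at a (k + y) ≡ k + at c y
  at-⊕ʳ y y<l = trans (at-++ʳ b (map (k +_) c) y) (at-map (k +_) c y y<l)

  module _ (b-within : Within k b) (c-within : Within l c) where

    permMatrix-⊕-covered : Covered (permMatrix a) (permMatrix b) (permMatrix c)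
    permMatrix-⊕-covered R C on with permMatrix-on⁻ a R C on
    ... | C<a , eq with offset k C
    ...   | inside C<k with offset l R
    ...     | inside R<l = ⊥-elim (<-irrefl (trans eq (trans length-⊕ (+-comm k l))) R+a<l+k)
      where
      R+a<l+k : R + at a C < l + k
      R+a<l+k = subst (λ v → R + v < l + k) (sym (at-⊕ˡ C C<k))
                      (+-mono-<-≤ R<l (proj₂ (at-All b C b-within C<k)))
    ...     | beyond x = admissibleBL (subst (x <_) x+b≡k (m<m+n x (proj₁ (at-All b C b-within C<k)))) C<k
                                      (permMatrix-on⁺ b x C C<k x+b≡k)
      where
      x+b≡k : x + at b C ≡ k
      x+b≡k = +-cancelˡ-≡ l _ _ (begin
        l + (x + at b C)  ≡⟨ sym (+-assoc l x _) ⟩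
        l + x + at b C    ≡⟨ cong (l + x +_) (sym (at-⊕ˡ C C<k)) ⟩
        l + x + at a C    ≡⟨ trans eq length-⊕ ⟩
        k + l             ≡⟨ +-comm k l ⟩
        l + k             ∎)
        where open ≡-Reasoning
    permMatrix-⊕-covered R C on | C<a , eq | beyond y =
      admissibleTR (subst (R <_) R+c≡l (m<m+n R (proj₁ (at-All c y c-within y<l)))) y<l
                   (permMatrix-on⁺ c R y y<l R+c≡l)
      where
      y<l : y < l
      y<l = k+y<n⁻ y (subst (k + y <_) length-⊕ C<a)
      R+c≡l : R + at c y ≡ l
      R+c≡l = +-cancelˡ-≡ k _ _ (begin
        k + (R + at c y)  ≡⟨ x∙yz≈y∙xz k R _ ⟩
        R + (k + at c y)  ≡⟨ cong (R +_) (sym (at-⊕ʳ y y<l)) ⟩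
        R + at a (k + y)  ≡⟨ trans eq length-⊕ ⟩
        k + l             ∎)
        where open ≡-Reasoning

    permMatrix-⊕-shiftedˡ : Shifted l 0 (permMatrix b) (permMatrix a)
    permMatrix-⊕-shiftedˡ x y on with permMatrix-on⁻ b x y on
    ... | y<k , eq = permMatrix-on⁺ a (l + x) y (subst (y <_) (sym length-⊕) (<-≤-trans y<k k≤n)) (begin
      l + x + at a y    ≡⟨ cong (l + x +_) (at-⊕ˡ y y<k) ⟩
      l + x + at b y    ≡⟨ +-assoc l x _ ⟩
      l + (x + at b y)  ≡⟨ cong (l +_) eq ⟩
      l + k             ≡⟨ +-comm l k ⟩
      n                 ≡⟨ sym length-⊕ ⟩
      length a          ∎)
      where open ≡-Reasoning

    permMatrix-⊕-shiftedʳ : Shifted 0 k (permMatrix c) (permMatrix a)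
    permMatrix-⊕-shiftedʳ r y on with permMatrix-on⁻ c r y on
    ... | y<l , eq = permMatrix-on⁺ a r (k + y) (subst (k + y <_) (sym length-⊕) (k+y<n y<l)) (begin
      r + at a (k + y)  ≡⟨ cong (r +_) (at-⊕ʳ y y<l) ⟩
      r + (k + at c y)  ≡⟨ x∙yz≈y∙xz r k _ ⟩
      k + (r + at c y)  ≡⟨ cong (k +_) eq ⟩
      n                 ≡⟨ sym length-⊕ ⟩
      length a          ∎)
      where open ≡-Reasoning

    FullPerm-⊕ : FullPerm a ⇔ (FullPerm b × FullPerm c)
    FullPerm-⊕ = mk⇔ project-a fill-a
      where
      project-a : FullPerm a → FullPerm b × FullPerm c
      project-a full with subst (λ N → Reach N (permMatrix a) (AllOnes N)) length-⊕ full
      ... | _ , run , all = project-full run all permMatrix-⊕-covered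
      fill-a : FullPerm b × FullPerm c → FullPerm a
      fill-a (fb , fc) = subst (λ N → Reach N (permMatrix a) (AllOnes N)) (sym length-⊕)
                               (fill-from-blocks permMatrix-⊕-shiftedˡ permMatrix-⊕-shiftedʳ fb fc)

FullPerm-⊕ : ∀ b c → Within (length b) b → Within (length c) c →
             FullPerm (b ⊕ c) ⇔ (FullPerm b × FullPerm c)
FullPerm-⊕ [] c _ _ =
  mk⇔ (λ full → FullPerm-[] , subst FullPerm (map-id c) full)
      (λ (_ , full) → subst FullPerm (sym (map-id c)) full)
FullPerm-⊕ b@(_ ∷ _) [] _ _ =
  mk⇔ (λ full → subst FullPerm (++-identityʳ b) full , FullPerm-[])
      (λ (full , _) → subst FullPerm (sym (++-identityʳ b)) full)
FullPerm-⊕ (x₀ ∷ b′) (z₀ ∷ c′) b-within c-within = ⊕-Blocks.FullPerm-⊕ x₀ z₀ b′ c′ b-within c-within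

-- Reduced forms

rank : List ℕ → ℕ → ℕ
rank w x = suc (length (filter (_<? x) w))

Below : List ℕ → List ℕ → Set
Below xs ys = All (λ x → All (x <_) ys) xs

reduce-++ : ∀ p r → Below p r → reduce (p ++ r) ≡ reduce p ⊕ reduce r
reduce-++ p r p<r = begin
  map (rank (p ++ r)) (p ++ r)                              ≡⟨ map-++ (rank (p ++ r)) p r ⟩
  map (rank (p ++ r)) p ++ map (rank (p ++ r)) r            ≡⟨ cong₂ _++_ (map-cong-local (All.map rank-left p<r))
                                                                          (map-cong-local (All.tabulate rank-right)) ⟩
  map (rank p) p ++ map ((length (reduce p) +_) ∘ rank r) r ≡⟨ cong (reduce p ++_) (map-∘ r) ⟩
  reduce p ⊕ reduce r                                       ∎
  where
  open ≡-Reasoning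
  rank-left : ∀ {x} → All (x <_) r → rank (p ++ r) x ≡ rank p x
  rank-left {x} x<r = cong (suc ∘ length) (begin
    filter (_<? x) (p ++ r)               ≡⟨ filter-++ (_<? x) p r ⟩
    filter (_<? x) p ++ filter (_<? x) r  ≡⟨ cong (filter (_<? x) p ++_) (filter-none (_<? x) (All.map <⇒≯ x<r)) ⟩
    filter (_<? x) p ++ []                ≡⟨ ++-identityʳ _ ⟩
    filter (_<? x) p                      ∎)
  rank-right : ∀ {y} → y ∈ r → rank (p ++ r) y ≡ length (reduce p) + rank r y
  rank-right {y} y∈r = begin
    suc (length (filter (_<? y) (p ++ r)))                     ≡⟨ cong (suc ∘ length) (filter-++ (_<? y) p r) ⟩
    suc (length (filter (_<? y) p ++ filter (_<? y) r))        ≡⟨ cong suc (length-++ (filter (_<? y) p)) ⟩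
    suc (length (filter (_<? y) p) + length (filter (_<? y) r)) ≡⟨ cong (λ q → suc (length q + _))
                                                                     (filter-all (_<? y) (All.map (λ x<r → All.lookup x<r y∈r) p<r)) ⟩
    suc (length p + length (filter (_<? y) r))                 ≡⟨ sym (+-suc (length p) _) ⟩
    length p + rank r y                                        ≡⟨ cong (_+ rank r y) (sym (length-map (rank p) p)) ⟩
    length (reduce p) + rank r y                               ∎
    where open Data.List.Properties using (length-++)

rank≤length : ∀ w {x} → x ∈ w → rank w x ≤ length w
rank≤length w {x} x∈w = filter-notAll (_<? x) w (Any.map (λ { refl → n≮n x }) x∈w)

reduce-within : ∀ w → Within (length (reduce w)) (reduce w)
reduce-within w rewrite length-map (rank w) w = Allₚ.map⁺ (All.tabulate λ x∈w → s≤s z≤n , rank≤length w x∈w)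

Unique-resp-↭ : ∀ {xs ys : List ℕ} → xs ↭ ys → Unique xs → Unique ys
Unique-resp-↭ xs↭ys = ↭ₛ.Unique-resp-↭ (setoid ℕ) (↭⇒↭ₛ xs↭ys)

rank-resp-↭ : ∀ {w w′} → w ↭ w′ → ∀ x → rank w x ≡ rank w′ x
rank-resp-↭ w↭w′ x = cong suc (↭-length (filter-↭ (_<? x) w↭w′))

reduce-resp-↭ : ∀ {w w′} → w ↭ w′ → reduce w ↭ reduce w′
reduce-resp-↭ {w} {w′} w↭w′ = ↭-trans (map⁺ (rank w) w↭w′) (↭-reflexive (map-cong (rank-resp-↭ w↭w′) w′))

[suc] : ∀ N → [ suc N ] ≡ 1 ∷ map suc [ N ]
[suc] N = cong (λ xs → 1 ∷ map suc xs) (sym (map-upTo suc N))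

reduce-increasing : ∀ {w} → AllPairs _<_ w → reduce w ≡ [ length w ]
reduce-increasing [] = refl
reduce-increasing {x ∷ u} (x<u ∷ u↑) = begin
  reduce ((x ∷ []) ++ u)            ≡⟨ reduce-++ (x ∷ []) u (x<u ∷ []) ⟩
  (rank (x ∷ []) x ∷ []) ⊕ reduce u  ≡⟨ cong (λ v → (v ∷ []) ⊕ reduce u) rank-self ⟩
  1 ∷ map suc (reduce u)             ≡⟨ cong (λ v → 1 ∷ map suc v) (reduce-increasing u↑) ⟩
  1 ∷ map suc [ length u ]           ≡⟨ sym ([suc] (length u)) ⟩
  [ suc (length u) ]                 ∎
  where
  open ≡-Reasoning
  rank-self : rank (x ∷ []) x ≡ 1
  rank-self = cong (suc ∘ length) (filter-reject (_<? x) {xs = []} (n≮n x))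

reduce-↭ : ∀ {w} → Unique w → reduce w ↭ [ length w ]
reduce-↭ {w} w! =
  ↭-trans (reduce-resp-↭ (↭-sym (sort-↭ w)))
          (↭-reflexive (trans (reduce-increasing sort-increasing) (cong [_] (↭-length (sort-↭ w)))))
  where
  sort-increasing : AllPairs _<_ (sort w)
  sort-increasing = AllPairs.zipWith (λ (x≤y , x≢y) → ≤∧≢⇒< x≤y x≢y)
    (Sorted⇒AllPairs (DecTotalOrder.totalOrder ≤-decTotalOrder) (sort-↗ w) , Unique-resp-↭ (↭-sym (sort-↭ w)) w!)

count<-mono : ∀ w {y x} → y ≤ x → length (filter (_<? y) w) ≤ length (filter (_<? x) w)
count<-mono w y≤x =
  length-mono-≤ (filter⁺ (_<? _) (_<? _) (λ { refl z<y → <-≤-trans z<y y≤x }) (⊆-refl {x = w}))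

rank-< : ∀ w {y x} → y < x → y ∈ w → rank w y < rank w x
rank-< (y ∷ w) {y} {x} y<x (here refl)
  rewrite filter-reject (_<? y) {xs = w} (n≮n y) | filter-accept (_<? x) {xs = w} y<x =
  s≤s (s≤s (count<-mono w (<⇒≤ y<x)))
rank-< (z ∷ w) {y} {x} y<x (there y∈w) with z <? y | z <? x
... | yes z<y | yes z<x rewrite filter-accept (_<? y) {xs = w} z<y | filter-accept (_<? x) {xs = w} z<x =
  s≤s (rank-< w y<x y∈w)
... | yes z<y | no  z≮x = ⊥-elim (z≮x (<-trans z<y y<x))
... | no  z≮y | yes z<x rewrite filter-reject (_<? y) {xs = w} z≮y | filter-accept (_<? x) {xs = w} z<x =
  m<n⇒m<1+n (rank-< w y<x y∈w)
... | no  z≮y | no  z≮x rewrite filter-reject (_<? y) {xs = w} z≮y | filter-reject (_<? x) {xs = w} z≮x =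
  rank-< w y<x y∈w

rank-injective : ∀ w {y z} → y ∈ w → z ∈ w → rank w y ≡ rank w z → y ≡ z
rank-injective w {y} {z} y∈w z∈w eq with <-cmp y z
... | tri< y<z _ _ = ⊥-elim (<-irrefl eq (rank-< w y<z y∈w))
... | tri≈ _ y≡z _ = y≡z
... | tri> _ _ z<y = ⊥-elim (<-irrefl (sym eq) (rank-< w z<y z∈w))

∈-[]⁻ : ∀ {v j} → v ∈ [ j ] → 1 ≤ v × v ≤ j
∈-[]⁻ v∈[j] with ∈-map⁻ suc v∈[j]
... | i , i∈upTo , refl with ∈-applyUpTo⁻ id i∈upTo
...   | _ , i<j , refl = s≤s z≤n , i<j

∈-[]⁺ : ∀ {v j} → 1 ≤ v → v ≤ j → v ∈ [ j ]
∈-[]⁺ {suc v} _ v<j = ∈-map⁺ suc (∈-upTo⁺ v<j)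

Unique-++-disjoint : ∀ (xs : List ℕ) {ys x} → Unique (xs ++ ys) → x ∈ xs → x ∈ ys → ⊥
Unique-++-disjoint (_ ∷ xs) (x≢ ∷ _)  (here refl) x∈ys = All.lookup (Allₚ.++⁻ʳ xs x≢) x∈ys refl
Unique-++-disjoint (_ ∷ xs) (_  ∷ u) (there x∈xs) x∈ys = Unique-++-disjoint xs u x∈xs x∈ys

take-++-≤ : ∀ j (p r : List ℕ) → j ≤ length p → take j (p ++ r) ≡ take j p
take-++-≤ zero    p       r _         = refl
take-++-≤ (suc j) (x ∷ p) r (s≤s j≤p) = cong (x ∷_) (take-++-≤ j p r j≤p)

drop-++-≤ : ∀ j (p r : List ℕ) → j ≤ length p → drop j (p ++ r) ≡ drop j p ++ r
drop-++-≤ zero    p       r _         = refl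
drop-++-≤ (suc j) (x ∷ p) r (s≤s j≤p) = drop-++-≤ j p r j≤p

length-take-≤ : ∀ j (w : List ℕ) → j ≤ length w → length (take j w) ≡ j
length-take-≤ j w j≤w = trans (length-take j w) (m≤n⇒m⊓n≡m j≤w)

SplitsAt : ℕ → List ℕ → Set
SplitsAt j w = Below (take j w) (drop j w)

SplitsAt-length : ∀ w → SplitsAt (length w) w
SplitsAt-length w =
  subst (Below (take (length w) w)) (sym (drop-all (length w) w ≤-refl)) (All.universal (λ _ → []) _)

take-length-++ : ∀ (p r : List ℕ) → take (length p) (p ++ r) ≡ p
take-length-++ p r = trans (take-++-≤ _ p r ≤-refl) (take-all _ p ≤-refl)

drop-length-++ : ∀ (p r : List ℕ) → drop (length p) (p ++ r) ≡ r
drop-length-++ p r = trans (drop-++-≤ _ p r ≤-refl) (cong (_++ r) (drop-all _ p ≤-refl))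

SplitsAt-++⇒Below : ∀ p r → SplitsAt (length p) (p ++ r) → Below p r
SplitsAt-++⇒Below p r = subst₂ Below (take-length-++ p r) (drop-length-++ p r)

SplitsAt-++ˡ : ∀ j p r → j ≤ length p → SplitsAt j (p ++ r) → SplitsAt j p
SplitsAt-++ˡ j p r j≤p split =
  All.map (λ x<rest → Allₚ.++⁻ˡ (drop j p) (subst (All _) (drop-++-≤ j p r j≤p) x<rest))
          (subst (All _) (take-++-≤ j p r j≤p) split)

SplitsAt-take : ∀ i j w → i ≤ j → j ≤ length w → SplitsAt i (take j w) → SplitsAt j w → SplitsAt i w
SplitsAt-take i j w i≤j j≤w split-i split-j = subst₂ Below (sym take-i) (sym drop-i) (All.tabulate below)
  where
  q : List ℕ
  q = take j w
  take-i : take i w ≡ take i q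
  take-i = sym (trans (take-take i j w) (cong (λ m → take m w) (m≤n⇒m⊓n≡m i≤j)))
  drop-i : drop i w ≡ drop i q ++ drop j w
  drop-i = trans (cong (drop i) (sym (take++drop≡id j w)))
                 (drop-++-≤ i q (drop j w) (subst (i ≤_) (sym (length-take-≤ j w j≤w)) i≤j))
  below : ∀ {x} → x ∈ take i q → All (x <_) (drop i q ++ drop j w)
  below x∈ = Allₚ.++⁺ (All.lookup split-i x∈) (All.lookup split-j (lookup (take-⊆ i q) x∈))

SplitsAt⇒take-reduce↭ : ∀ j w → Unique w → j ≤ length w → SplitsAt j w → take j (reduce w) ↭ [ j ]
SplitsAt⇒take-reduce↭ j w w! j≤w split =
  ↭-trans (↭-reflexive take-reduce)
          (subst (λ m → reduce t ↭ [ m ]) (length-take-≤ j w j≤w) (reduce-↭ (Unique.take⁺ j w!)))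
  where
  t : List ℕ
  t = take j w
  length-reduce-t : length (reduce t) ≡ j
  length-reduce-t = trans (length-map (rank t) t) (length-take-≤ j w j≤w)
  take-reduce : take j (reduce w) ≡ reduce t
  take-reduce = begin
    take j (reduce w)                      ≡⟨ cong (take j ∘ reduce) (sym (take++drop≡id j w)) ⟩
    take j (reduce (t ++ drop j w))        ≡⟨ cong (take j) (reduce-++ t (drop j w) split) ⟩
    take j (reduce t ⊕ reduce (drop j w))  ≡⟨ take-++-≤ j (reduce t) _ (≤-reflexive (sym length-reduce-t)) ⟩
    take j (reduce t)                      ≡⟨ take-all j (reduce t) (≤-reflexive length-reduce-t) ⟩
    reduce t                               ∎
    where open ≡-Reasoning

take-reduce↭⇒SplitsAt : ∀ j w → Unique w → take j (reduce w) ↭ [ j ] → SplitsAt j w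
take-reduce↭⇒SplitsAt j w w! prefix↭ = All.tabulate λ x∈ → All.tabulate λ y∈ → ordered x∈ y∈
  where
  not-both : ∀ {x} → x ∈ take j w → x ∈ drop j w → ⊥
  not-both = Unique-++-disjoint (take j w) (subst Unique (sym (take++drop≡id j w)) w!)
  ordered : ∀ {x y} → x ∈ take j w → y ∈ drop j w → x < y
  ordered {x} {y} x∈ y∈ with <-cmp x y
  ... | tri< x<y _ _ = x<y
  ... | tri≈ _ refl _ = ⊥-elim (not-both x∈ y∈)
  ... | tri> _ _ y<x = ⊥-elim (not-both (subst (_∈ take j w) (sym y≡z) z∈) y∈)
    where
    ranks : take j (reduce w) ≡ map (rank w) (take j w)
    ranks = take-map j w
    rank-x≤j : rank w x ≤ j
    rank-x≤j = proj₂ (∈-[]⁻ (∈-resp-↭ prefix↭ (subst (rank w x ∈_) (sym ranks) (∈-map⁺ (rank w) x∈))))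
    rank-y∈ : rank w y ∈ map (rank w) (take j w)
    rank-y∈ = subst (rank w y ∈_) ranks (∈-resp-↭ (↭-sym prefix↭)
                (∈-[]⁺ (s≤s z≤n) (<⇒≤ (<-≤-trans (rank-< w y<x (lookup (drop-⊆ j w) y∈)) rank-x≤j))))
    z : ℕ
    z = proj₁ (∈-map⁻ (rank w) rank-y∈)
    z∈ : z ∈ take j w
    z∈ = proj₁ (proj₂ (∈-map⁻ (rank w) rank-y∈))
    y≡z : y ≡ z
    y≡z = rank-injective w (lookup (drop-⊆ j w) y∈) (lookup (take-⊆ j w) z∈)
                           (proj₂ (proj₂ (∈-map⁻ (rank w) rank-y∈)))

-- Components

splitsAt? : ∀ j w → Dec (SplitsAt j w)
splitsAt? j w = All.all? (λ x → All.all? (x <?_) (drop j w)) (take j w)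

least-witness : ∀ {P : ℕ → Set} → Decidable P → ∀ {n} → P n → ∃ λ m → P m × (∀ i → i < m → ¬ P i)
least-witness {P} P? {n} pn = search 0 n (λ _ ()) pn
  where
  search : ∀ m d → (∀ i → i < m → ¬ P i) → P (m + d) → ∃ λ m → P m × (∀ i → i < m → ¬ P i)
  search m d below pm+d with P? m
  ... | yes pm = m , pm , below
  search m zero    below pm+d | no ¬pm = ⊥-elim (¬pm (subst P (+-identityʳ m) pm+d))
  search m (suc d) below pm+d | no ¬pm = search (suc m) d (∀<suc below ¬pm) (subst P (+-suc m d) pm+d)

first-component-below : ∀ p r → Unique (p ++ r) → p ≢ [] → Indec p →
                        (∀ m → length p < m → m ≤ length (p ++ r) → ¬ Indec (take m (p ++ r))) → Below p r
first-component-below [] r _ p≢[] _ _ = ⊥-elim (p≢[] refl)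
first-component-below p@(_ ∷ _) r w! _ indec maximal
  with least-witness (λ i → splitsAt? (suc i) (p ++ r)) (SplitsAt-length (p ++ r))
... | j₀ , split , minimal with <-cmp (suc j₀) (length p)
...   | tri< j<p _ _ = ⊥-elim (indec (suc j₀) (s≤s z≤n) (subst (suc j₀ <_) (sym (length-map (rank p) p)) j<p) prefix↭)
  where
  p! : Unique p
  p! = subst Unique (take-length-++ p r) (Unique.take⁺ (length p) w!)
  prefix↭ : take (suc j₀) (reduce p) ↭ [ suc j₀ ]
  prefix↭ = SplitsAt⇒take-reduce↭ (suc j₀) p p! (<⇒≤ j<p) (SplitsAt-++ˡ (suc j₀) p r (<⇒≤ j<p) split)
...   | tri≈ _ j≡p _ = SplitsAt-++⇒Below p r (subst (λ j → SplitsAt j (p ++ r)) j≡p split)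
...   | tri> _ _ p<j = ⊥-elim (maximal (suc j₀) p<j j≤w prefix-indec)
  where
  w : List ℕ
  w = p ++ r
  j≤w : suc j₀ ≤ length w
  j≤w = ≮⇒≥ λ w<j → minimal _ (≤-pred w<j) (SplitsAt-length w)
  prefix-indec : Indec (take (suc j₀) w)
  prefix-indec zero    () _
  prefix-indec (suc i) _  i<j prefix↭ = minimal i i<j₀
    (SplitsAt-take (suc i) (suc j₀) w (<⇒≤ (s≤s i<j₀)) j≤w
                   (take-reduce↭⇒SplitsAt (suc i) _ (Unique.take⁺ (suc j₀) w!) prefix↭) split)
    where
    i<j₀ : i < j₀
    i<j₀ = ≤-pred (subst (suc i <_) (trans (length-map _ (take (suc j₀) w)) (length-take-≤ _ w j≤w)) i<j)

Full-++ : ∀ p r → Below p r → Full (p ++ r) ⇔ (Full p × Full r)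
Full-++ p r p<r = subst (λ a → FullPerm a ⇔ (Full p × Full r)) (sym (reduce-++ p r p<r))
                        (FullPerm-⊕ (reduce p) (reduce r) (reduce-within p) (reduce-within r))

Full-components : ∀ {w cs} → Unique w → Components w cs → Full w ⇔ All Full cs
Full-components _  done = mk⇔ (λ _ → []) (λ _ → FullPerm-[])
Full-components {cs = _ ∷ cs} w! (next p rest p≢[] refl indec maximal comps) = mk⇔
  (λ full → let (full-p , full-rest) = to split full in full-p ∷ to ih full-rest)
  (λ { (full-p ∷ full-cs) → from split (full-p , from ih full-cs) })
  where
  open Equivalence
  split : Full (p ++ rest) ⇔ (Full p × Full rest)
  split = Full-++ p rest (first-component-below p rest w! p≢[] indec maximal)
  ih : Full rest ⇔ All Full cs
  ih = Full-components (subst Unique (drop-length-++ p rest) (Unique.drop⁺ (length p) w!)) comps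

theorem4p11 : (n : ℕ) → 1 ≤ n → (π : List ℕ) → π ↭ [ n ] →
              (cs : List (List ℕ)) → Components π cs →
              (Full π ⇔ All Full cs)
theorem4p11 n _ π π↭[n] cs comps = Full-components (Unique-resp-↭ (↭-sym π↭[n]) [n]-unique) comps
  where
  [n]-unique : Unique [ n ]
  [n]-unique = Unique.map⁺ suc-injective (Unique.upTo⁺ n)
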